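{- For every connected weighted graph $(G,\mathbf{w})$ there exists a positive integer $\mu$ such that $\beta(G,\mathbf{w})=\frac{c_{\mu}(G,\mathbf{w})}{\mu}$.
   Context: A weighted graph $(G,\mathbf{w})$ is a finite simple graph with positive integer edge weights that is weight-minimal: every edge is a shortest path between its endpoints. $d_\mathbf{w}(u,v)$ is the minimum total weight of a $(u,v)$-path. For a positive integer $\lambda$, $c_\lambda(G,\mathbf{w})$ is the minimum $m$ such that there is $f:V(G)\to\{0,1\}^m$ with $\lambda\, d_\mathbf{w}(u,v)\le d_H(f(u),f(v))$ for all $u,v$ ($d_H$ the Hamming distance). $\beta(G,\mathbf{w}):=\lim_{\lambda\to\infty} c_\lambda(G,\mathbf{w})/\lambda$ (this limit exists by subadditivity). -}

module Defs where

open import Data.Nat using (ℕ; zero; suc; _+_; _*_; _≤_; _<_; NonZero)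
open import Data.Fin using (Fin)
open import Data.Bool using (Bool; true; false; if_then_else_)
open import Data.Vec using (Vec; []; _∷_)
open import Data.List using (List; []; _∷_)
open import Data.List.Relation.Unary.Unique.Propositional using (Unique)
open import Data.Product using (Σ; _×_; _,_; ∃)
open import Relation.Binary.PropositionalEquality using (_≡_; _≢_)
open import Relation.Nullary using (¬_)
open import Data.Integer using (+_)
open import Data.Rational as ℚ using (ℚ)

data Walk {n : ℕ} (adj : Fin n → Fin n → Bool) : Fin n → Fin n → Set where
  stop : (u : Fin n) → Walk adj u u
  step : (u : Fin n) {v x : Fin n} → adj u v ≡ true → Walk adj v x → Walk adj u x

vertices : {n : ℕ} {adj : Fin n → Fin n → Bool} {u v : Fin n} → Walk adj u v → List (Fin n)
vertices (stop u) = u ∷ []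
vertices (step u _ p) = u ∷ vertices p

Path : {n : ℕ} (adj : Fin n → Fin n → Bool) → Fin n → Fin n → Set
Path adj u v = Σ (Walk adj u v) (λ p → Unique (vertices p))

walkWeight : {n : ℕ} {adj : Fin n → Fin n → Bool} (w : Fin n → Fin n → ℕ) {u v : Fin n} → Walk adj u v → ℕ
walkWeight w (stop u) = 0
walkWeight w (step u {v} _ p) = w u v + walkWeight w p

pathWeight : {n : ℕ} {adj : Fin n → Fin n → Bool} (w : Fin n → Fin n → ℕ) {u v : Fin n} → Path adj u v → ℕ
pathWeight w (p , _) = walkWeight w p

-- A weighted graph on vertex set Fin n: a finite simple graph (symmetric,
-- irreflexive adjacency) with positive integer edge weights (w u v is the
-- weight of edge uv; its value on non-edges is irrelevant), which is
-- weight-minimal: every edge is a shortest path between its endpoints.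
record WeightedGraph (n : ℕ) : Set where
  field
    adj        : Fin n → Fin n → Bool
    w          : Fin n → Fin n → ℕ
    adj-sym    : ∀ u v → adj u v ≡ true → adj v u ≡ true
    adj-irrefl : ∀ u → adj u u ≡ false
    w-sym      : ∀ u v → adj u v ≡ true → w u v ≡ w v u
    w-pos      : ∀ u v → adj u v ≡ true → 1 ≤ w u v
    w-minimal  : ∀ u v → adj u v ≡ true → (p : Path adj u v) → w u v ≤ pathWeight w p

open WeightedGraph public

Connected : {n : ℕ} → WeightedGraph n → Set
Connected G = ∀ u v → Path (adj G) u v

IsDist : {n : ℕ} → WeightedGraph n → Fin n → Fin n → ℕ → Set
IsDist G u v d =
  (Σ (Path (adj G) u v) (λ p → pathWeight (w G) p ≡ d)) ×
  ((p : Path (adj G) u v) → d ≤ pathWeight (w G) p)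

hamming : {m : ℕ} → Vec Bool m → Vec Bool m → ℕ
hamming [] [] = 0
hamming (a ∷ as) (b ∷ bs) = (if a Data.Bool.xor b then 1 else 0) + hamming as bs

IsEmbedding : {n : ℕ} → WeightedGraph n → (lam m : ℕ) → (Fin n → Vec Bool m) → Set
IsEmbedding G lam m f = ∀ u v d → IsDist G u v d → lam * d ≤ hamming (f u) (f v)

Embeds : {n : ℕ} → WeightedGraph n → (lam m : ℕ) → Set
Embeds {n} G lam m = Σ (Fin n → Vec Bool m) (IsEmbedding G lam m)

IsC : {n : ℕ} → WeightedGraph n → (lam c : ℕ) → Set
IsC G lam c = Embeds G lam c × (∀ m → m < c → ¬ Embeds G lam m)

_÷_ : (a b : ℕ) → .{{NonZero b}} → ℚ
a ÷ b = (+ a) ℚ./ b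

-- β(G,w) = q : the sequence c_λ(G,w)/λ converges to q as λ → ∞,
-- i.e. for every rational ε > 0 there is N such that |c_λ/λ - q| < ε for all λ ≥ N.
-- (λ ranges over positive integers; we write λ = suc k.)
BetaIs : {n : ℕ} → WeightedGraph n → ℚ → Set
BetaIs G q = ∀ (ε : ℚ) → ℚ.0ℚ ℚ.< ε →
  ∃ λ N → ∀ k → N ≤ suc k → ∀ c → IsC G (suc k) c →
    ℚ.∣ (c ÷ suc k) ℚ.- q ∣ ℚ.< ε

{-# OPTIONS --safe #-}
module Submission where

-- An embedding f : V → {0,1}^m is a multiset of m cuts (its columns), and d_H(f u, f v)
-- counts those separating u from v; so c_λ is the least total weight of a cut weighting x
-- with λ·d(u,v) ≤ Σ {x(C) : C separates u, v}.  Write k·x = λ·q_k + r_k cutwise.  Each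
-- remainder distance R_k(u,v) is below (#cuts + 1)·λ, so once λ exceeds the number of
-- possible profiles ⌊R_k/λ⌋ some k < k′ < λ share a profile, and then q_k′ − q_k and
-- q_{k+λ} − q_k′ (note q_{k+λ} = q_k + x) are feasible for k′ − k and λ − (k′ − k) and
-- add up to x.  Hence c_a + c_b ≤ c_λ for a split λ = a + b of every large λ.  With
-- subadditivity this makes the least ratio c_μ/μ over an initial range a global minimum,
-- and c_λ ≤ c_μ⌈λ/μ⌉ squeezes c_λ/λ to c_μ/μ.

open import Defs
open import Data.Nat using (ℕ; suc)
open import Data.Product using (Σ; _×_)

open import Data.Bool as Bool using (Bool; true; false; if_then_else_; _xor_)
open import Data.Fin as Fin using (Fin; zero; suc; toℕ; fromℕ<; funToFin; finToFun)
import Data.Fin.Properties as Fin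
import Data.Integer as ℤ
import Data.Integer.Properties as ℤ
open import Data.List.Membership.Propositional using (_∈_)
import Data.List.Membership.DecPropositional as DecMembership
open import Data.List.Relation.Unary.All using ([]; _∷_)
open import Data.List.Relation.Unary.All.Properties using (¬Any⇒All¬)
open import Data.List.Relation.Unary.AllPairs using ([]; _∷_)
open import Data.List.Relation.Unary.Any using (here; there)
open import Data.List.Relation.Unary.Unique.Propositional using (Unique)
open import Data.Nat
open import Data.Nat.DivMod
open import Data.Nat.Divisibility using (n∣m*n)
open import Data.Nat.Induction using (<-rec)
open import Data.Nat.Properties
open import Algebra.Properties.CommutativeSemigroup +-commutativeSemigroup using (interchange)
open import Data.Nat.Tactic.RingSolver using (solve-∀)
open import Data.Product using (∃; ∃₂; _,_; proj₁; proj₂)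
open import Data.Rational as ℚ using (ℚ; mkℚ)
import Data.Rational.Properties as ℚ
import Data.Rational.Unnormalised as ℚᵘ
import Data.Rational.Unnormalised.Properties as ℚᵘ
open import Data.Sum using (_⊎_; inj₁; inj₂)
open import Data.Vec using (Vec; []; _∷_; lookup; tabulate; replicate; _++_; head; tail)
open import Data.Vec.Properties using (lookup∘tabulate)
open import Function using (_∘_; id)
open import Relation.Binary.Core using (_Preserves_⟶_)
open import Relation.Binary.PropositionalEquality
open import Relation.Nullary using (Dec; yes; no; ¬_; does; contradiction)
open import Relation.Nullary.Decidable as Dec using (_×-dec_)
open import Relation.Unary using (Decidable)

private
  variable
    n m : ℕ
    A : Set

IsLeast : (ℕ → Set) → ℕ → Set
IsLeast P k = P k × (∀ j → j < k → ¬ P j)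

IsLeast⇒≤ : ∀ {P k m} → IsLeast P k → P m → k ≤ m
IsLeast⇒≤ (_ , below) p = ≮⇒≥ (λ m<k → below _ m<k p)

IsLeast-unique : ∀ {P j k} → IsLeast P j → IsLeast P k → j ≡ k
IsLeast-unique least-j least-k =
  ≤-antisym (IsLeast⇒≤ least-j (proj₁ least-k)) (IsLeast⇒≤ least-k (proj₁ least-j))

module _ {P : ℕ → Set} (P? : Decidable P) where

  least-or-none : ∀ m → ∃ (IsLeast P) ⊎ (∀ j → j ≤ m → ¬ P j)
  least-or-none zero with P? 0
  ... | yes p = inj₁ (0 , p , λ _ ())
  ... | no ¬p = inj₂ λ { zero _ → ¬p }
  least-or-none (suc m) with least-or-none m | P? (suc m)
  ... | inj₁ found | _ = inj₁ found
  ... | inj₂ none | yes p = inj₁ (suc m , p , λ j j<1+m → none j (s≤s⁻¹ j<1+m))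
  ... | inj₂ none | no ¬p = inj₂ none′
    where
    none′ : ∀ j → j ≤ suc m → ¬ P j
    none′ j j≤1+m with m≤n⇒m<n∨m≡n j≤1+m
    ... | inj₁ j<1+m = none j (s≤s⁻¹ j<1+m)
    ... | inj₂ refl = ¬p

  least : ∀ {m} → P m → ∃ (IsLeast P)
  least {m} p with least-or-none m
  ... | inj₁ found = found
  ... | inj₂ none = contradiction p (none m ≤-refl)

Searchable : Set → Set₁
Searchable A = ∀ {P : A → Set} → Decidable P → Dec (∃ P)

searchable-Bool : Searchable Bool
searchable-Bool P? with P? true | P? false
... | yes p | _ = yes (true , p)
... | no _ | yes p = yes (false , p)
... | no ¬t | no ¬f = no λ { (true , p) → ¬t p ; (false , p) → ¬f p }

searchable-Vec : Searchable A → ∀ n → Searchable (Vec A n)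
searchable-Vec search zero P? = Dec.map′ ([] ,_) (λ { ([] , p) → p }) (P? [])
searchable-Vec search (suc n) P? =
  Dec.map′ (λ (a , v , p) → a ∷ v , p) (λ { (a ∷ v , p) → a , v , p })
           (search (λ a → searchable-Vec search n (P? ∘ (a ∷_))))

maxOver : (Fin n → ℕ) → ℕ
maxOver {zero} f = 0
maxOver {suc n} f = f zero ⊔ maxOver (f ∘ suc)

≤-maxOver : (f : Fin n → ℕ) (i : Fin n) → f i ≤ maxOver f
≤-maxOver f zero = m≤m⊔n _ _
≤-maxOver f (suc i) = ≤-trans (≤-maxOver (f ∘ suc) i) (m≤n⊔m _ _)

matrixCode : ∀ {s} → (Fin n → Fin n → Fin s) → Fin ((s ^ n) ^ n)
matrixCode M = funToFin (funToFin ∘ M)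

matrixCode-injective : ∀ {s} {M N : Fin n → Fin n → Fin s} →
  matrixCode M ≡ matrixCode N → ∀ u v → M u v ≡ N u v
matrixCode-injective {M = M} {N} eq u v = begin
  M u v                                        ≡⟨ decode M ⟨
  finToFun (finToFun (matrixCode M) u) v       ≡⟨ cong (λ t → finToFun (finToFun t u) v) eq ⟩
  finToFun (finToFun (matrixCode N) u) v       ≡⟨ decode N ⟩
  N u v                                        ∎
  where
  open ≡-Reasoning
  decode : ∀ M → finToFun (finToFun (matrixCode M) u) v ≡ M u v
  decode M = trans (cong (λ t → finToFun t v) (Fin.finToFun-funToFin (funToFin ∘ M) u))
                   (Fin.finToFun-funToFin (M u) v)

pigeonhole-matrix : ∀ {l s} → (s ^ n) ^ n < l → (M : Fin l → Fin n → Fin n → Fin s) →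
  ∃₂ λ i j → i Fin.< j × (∀ u v → M i u v ≡ M j u v)
pigeonhole-matrix bound M with Fin.pigeonhole bound (matrixCode ∘ M)
... | i , j , i<j , sameCode = i , j , i<j , matrixCode-injective sameCode

m/o≡n/o⇒n<m+o : ∀ m n o .{{_ : NonZero o}} → m / o ≡ n / o → n < m + o
m/o≡n/o⇒n<m+o m n o eq = begin-strict
  n                 ≡⟨ m≡m%n+[m/n]*n n o ⟩
  n % o + n / o * o <⟨ +-monoˡ-< (n / o * o) (m%n<n n o) ⟩
  o + n / o * o     ≡⟨ cong (λ t → o + t * o) eq ⟨
  o + m / o * o     ≤⟨ +-monoʳ-≤ o (m/n*n≤m m o) ⟩
  o + m             ≡⟨ +-comm o m ⟩
  m + o             ∎
  where open ≤-Reasoning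

quotient-gap : ∀ l {q q′ r r′ y t} → l * q′ + r′ ≡ y + (l * q + r) → r′ < r + l → l * t ≤ y →
  t + q ≤ q′
quotient-gap l {q} {q′} {r} {r′} {y} {t} eq r′<r+l lt≤y =
  s≤s⁻¹ (subst (suc (t + q) ≤_) (+-comm q′ 1) (*-cancelˡ-< l _ _ (+-cancelʳ-< r _ _ scaled)))
  where
  open ≤-Reasoning
  regroup : ∀ l q′ r → l * q′ + (r + l) ≡ l * (q′ + 1) + r
  regroup = solve-∀
  scaled : l * (t + q) + r < l * (q′ + 1) + r
  scaled = begin-strict
    l * (t + q) + r       ≡⟨ trans (cong (_+ r) (*-distribˡ-+ l t q)) (+-assoc (l * t) (l * q) r) ⟩
    l * t + (l * q + r)   ≤⟨ +-monoˡ-≤ (l * q + r) lt≤y ⟩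
    y + (l * q + r)       ≡⟨ eq ⟨
    l * q′ + r′           <⟨ +-monoʳ-< (l * q′) r′<r+l ⟩
    l * q′ + (r + l)      ≡⟨ regroup l q′ r ⟩
    l * (q′ + 1) + r      ∎

[n∸m]+[o∸n]≡o∸m : ∀ {m n o} → m ≤ n → n ≤ o → (n ∸ m) + (o ∸ n) ≡ o ∸ m
[n∸m]+[o∸n]≡o∸m {m} {n} {o} m≤n n≤o = begin
  (n ∸ m) + (o ∸ n)  ≡⟨ +-comm (n ∸ m) (o ∸ n) ⟩
  (o ∸ n) + (n ∸ m)  ≡⟨ +-∸-assoc (o ∸ n) m≤n ⟨
  (o ∸ n) + n ∸ m    ≡⟨ cong (_∸ m) (m∸n+n≡m n≤o) ⟩
  o ∸ m              ∎
  where open ≡-Reasoning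

∑ : (k : ℕ) → (Vec Bool k → ℕ) → ℕ
∑ zero g = g []
∑ (suc k) g = ∑ k (g ∘ (true ∷_)) + ∑ k (g ∘ (false ∷_))

∑-cong : ∀ k {f g : Vec Bool k → ℕ} → (∀ c → f c ≡ g c) → ∑ k f ≡ ∑ k g
∑-cong zero eq = eq []
∑-cong (suc k) eq = cong₂ _+_ (∑-cong k (eq ∘ (true ∷_))) (∑-cong k (eq ∘ (false ∷_)))

∑-mono-≤ : ∀ k {f g : Vec Bool k → ℕ} → (∀ c → f c ≤ g c) → ∑ k f ≤ ∑ k g
∑-mono-≤ zero le = le []
∑-mono-≤ (suc k) le = +-mono-≤ (∑-mono-≤ k (le ∘ (true ∷_))) (∑-mono-≤ k (le ∘ (false ∷_)))

∑-zero : ∀ k → ∑ k (λ _ → 0) ≡ 0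
∑-zero zero = refl
∑-zero (suc k) = cong₂ _+_ (∑-zero k) (∑-zero k)

∑-distrib-+ : ∀ k (f g : Vec Bool k → ℕ) → ∑ k (λ c → f c + g c) ≡ ∑ k f + ∑ k g
∑-distrib-+ zero f g = refl
∑-distrib-+ (suc k) f g =
  trans (cong₂ _+_ (∑-distrib-+ k (f ∘ (true ∷_)) (g ∘ (true ∷_)))
                   (∑-distrib-+ k (f ∘ (false ∷_)) (g ∘ (false ∷_))))
        (interchange (∑ k (f ∘ (true ∷_))) (∑ k (g ∘ (true ∷_))) _ _)

∑-distribˡ-* : ∀ k a (f : Vec Bool k → ℕ) → ∑ k (λ c → a * f c) ≡ a * ∑ k f
∑-distribˡ-* zero a f = refl
∑-distribˡ-* (suc k) a f =
  trans (cong₂ _+_ (∑-distribˡ-* k a _) (∑-distribˡ-* k a _)) (sym (*-distribˡ-+ a _ _))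

∑-∸ : ∀ k (f g : Vec Bool k → ℕ) → (∀ c → g c ≤ f c) → ∑ k (λ c → f c ∸ g c) ≡ ∑ k f ∸ ∑ k g
∑-∸ k f g g≤f = begin
  ∑ k (λ c → f c ∸ g c)                       ≡⟨ m+n∸n≡m _ (∑ k g) ⟨
  ∑ k (λ c → f c ∸ g c) + ∑ k g ∸ ∑ k g       ≡⟨ cong (_∸ ∑ k g) (∑-distrib-+ k _ g) ⟨
  ∑ k (λ c → f c ∸ g c + g c) ∸ ∑ k g         ≡⟨ cong (_∸ ∑ k g) (∑-cong k (λ c → m∸n+n≡m (g≤f c))) ⟩
  ∑ k f ∸ ∑ k g                               ∎
  where open ≡-Reasoning

≤-∑ : ∀ k (f : Vec Bool k → ℕ) c → f c ≤ ∑ k f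
≤-∑ zero f [] = ≤-refl
≤-∑ (suc k) f (true ∷ c) = ≤-trans (≤-∑ k (f ∘ (true ∷_)) c) (m≤m+n _ _)
≤-∑ (suc k) f (false ∷ c) = ≤-trans (≤-∑ k (f ∘ (false ∷_)) c) (m≤n+m _ _)

δ : ∀ {k} → Vec Bool k → Vec Bool k → ℕ
δ [] [] = 1
δ (true ∷ c) (true ∷ y) = δ c y
δ (false ∷ c) (false ∷ y) = δ c y
δ (true ∷ c) (false ∷ y) = 0
δ (false ∷ c) (true ∷ y) = 0

∑-δ : ∀ k (g : Vec Bool k → ℕ) y → ∑ k (λ c → δ c y * g c) ≡ g y
∑-δ zero g [] = +-identityʳ (g [])
∑-δ (suc k) g (true ∷ y) =
  trans (cong₂ _+_ (∑-δ k (g ∘ (true ∷_)) y) (∑-zero k)) (+-identityʳ _)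
∑-δ (suc k) g (false ∷ y) =
  trans (cong (_+ ∑ k (λ c → δ c y * g (false ∷ c))) (∑-zero k)) (∑-δ k (g ∘ (false ∷_)) y)

Cut : ℕ → Set
Cut n = Vec Bool n

Weighting : ℕ → Set
Weighting n = Cut n → ℕ

separates : Cut n → Fin n → Fin n → ℕ
separates c u v = if lookup c u xor lookup c v then 1 else 0

cutDist : Weighting n → Fin n → Fin n → ℕ
cutDist {n} x u v = ∑ n (λ c → x c * separates c u v)

Demand : ℕ → Set₁
Demand n = Fin n → Fin n → ℕ → Set

Feasible : Demand n → ℕ → Weighting n → Set
Feasible Δ l x = ∀ u v d → Δ u v d → l * d ≤ cutDist x u v

separates≤1 : ∀ (c : Cut n) u v → separates c u v ≤ 1
separates≤1 c u v with lookup c u xor lookup c v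
... | true = ≤-refl
... | false = z≤n

cutDist-∸ : ∀ (x y : Weighting n) → (∀ c → y c ≤ x c) → ∀ u v →
  cutDist (λ c → x c ∸ y c) u v ≡ cutDist x u v ∸ cutDist y u v
cutDist-∸ {n} x y y≤x u v =
  trans (∑-cong n (λ c → *-distribʳ-∸ (separates c u v) (x c) (y c)))
        (∑-∸ n _ _ (λ c → *-monoˡ-≤ (separates c u v) (y≤x c)))

singleton : Fin n → Cut n
singleton u = tabulate (λ t → does (t Fin.≟ u))

separates-singleton : ∀ {u v : Fin n} → u ≢ v → separates (singleton u) u v ≡ 1
separates-singleton {u = u} {v} u≢v
  rewrite lookup∘tabulate (λ t → does (t Fin.≟ u)) u | lookup∘tabulate (λ t → does (t Fin.≟ u)) v
  with u Fin.≟ u | v Fin.≟ u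
... | yes _ | no _ = refl
... | no u≢u | _ = contradiction refl u≢u
... | yes _ | yes v≡u = contradiction (sym v≡u) u≢v

hamming-∷ : ∀ {m} (xs ys : Vec Bool (suc m)) →
  hamming xs ys ≡ (if head xs xor head ys then 1 else 0) + hamming (tail xs) (tail ys)
hamming-∷ (a ∷ xs) (b ∷ ys) = refl

hamming-++ : ∀ {a b} (xs xs′ : Vec Bool a) (ys ys′ : Vec Bool b) →
  hamming (xs ++ ys) (xs′ ++ ys′) ≡ hamming xs xs′ + hamming ys ys′
hamming-++ [] [] ys ys′ = refl
hamming-++ (x ∷ xs) (x′ ∷ xs′) ys ys′ =
  trans (cong (s +_) (hamming-++ xs xs′ ys ys′)) (sym (+-assoc s (hamming xs xs′) _))
  where
  s : ℕ
  s = if x xor x′ then 1 else 0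

hamming-replicate : ∀ k a b →
  hamming (replicate k a) (replicate k b) ≡ k * (if a xor b then 1 else 0)
hamming-replicate zero a b = refl
hamming-replicate (suc k) a b = cong (_ +_) (hamming-replicate k a b)

firstColumn : (Fin n → Vec Bool (suc m)) → Cut n
firstColumn f = tabulate (head ∘ f)

separates-firstColumn : ∀ (f : Fin n → Vec Bool (suc m)) u v →
  separates (firstColumn f) u v ≡ (if head (f u) xor head (f v) then 1 else 0)
separates-firstColumn f u v =
  cong₂ (λ a b → if a xor b then 1 else 0) (lookup∘tabulate (head ∘ f) u) (lookup∘tabulate (head ∘ f) v)

multiplicity : (Fin n → Vec Bool m) → Weighting n
multiplicity {m = zero} f c = 0
multiplicity {m = suc m} f c = δ c (firstColumn f) + multiplicity (tail ∘ f) c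

∑-multiplicity : ∀ (f : Fin n → Vec Bool m) → ∑ n (multiplicity f) ≡ m
∑-multiplicity {n} {zero} f = ∑-zero n
∑-multiplicity {n} {suc m} f = begin
  ∑ n (λ c → δ c (firstColumn f) + multiplicity (tail ∘ f) c)  ≡⟨ ∑-distrib-+ n _ _ ⟩
  ∑ n (λ c → δ c (firstColumn f)) + ∑ n (multiplicity (tail ∘ f))
    ≡⟨ cong₂ _+_ (∑-cong n (λ c → sym (*-identityʳ _))) (∑-multiplicity (tail ∘ f)) ⟩
  ∑ n (λ c → δ c (firstColumn f) * 1) + m                        ≡⟨ cong (_+ m) (∑-δ n _ _) ⟩
  suc m                                                          ∎
  where open ≡-Reasoning

hamming≡cutDist-multiplicity : ∀ (f : Fin n → Vec Bool m) u v →
  hamming (f u) (f v) ≡ cutDist (multiplicity f) u v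
hamming≡cutDist-multiplicity {n} {zero} f u v with f u | f v
... | [] | [] = sym (∑-zero n)
hamming≡cutDist-multiplicity {n} {suc m} f u v = begin
  hamming (f u) (f v)
    ≡⟨ hamming-∷ (f u) (f v) ⟩
  (if head (f u) xor head (f v) then 1 else 0) + hamming (tail (f u)) (tail (f v))
    ≡⟨ cong₂ _+_ (sym (separates-firstColumn f u v)) (hamming≡cutDist-multiplicity (tail ∘ f) u v) ⟩
  separates c₀ u v + cutDist (multiplicity (tail ∘ f)) u v
    ≡⟨ cong (_+ cutDist (multiplicity (tail ∘ f)) u v) (∑-δ n (λ c → separates c u v) c₀) ⟨
  ∑ n (λ c → δ c c₀ * separates c u v) + cutDist (multiplicity (tail ∘ f)) u v
    ≡⟨ ∑-distrib-+ n _ _ ⟨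
  ∑ n (λ c → δ c c₀ * separates c u v + multiplicity (tail ∘ f) c * separates c u v)
    ≡⟨ ∑-cong n (λ c → *-distribʳ-+ (separates c u v) (δ c c₀) _) ⟨
  cutDist (multiplicity f) u v
    ∎
  where
  open ≡-Reasoning
  c₀ : Cut n
  c₀ = firstColumn f

cutsEmbedding : ∀ k → (Vec Bool k → Cut n) → (x : Vec Bool k → ℕ) → Fin n → Vec Bool (∑ k x)
cutsEmbedding zero cut x u = replicate (x []) (lookup (cut []) u)
cutsEmbedding (suc k) cut x u =
  cutsEmbedding k (cut ∘ (true ∷_)) (x ∘ (true ∷_)) u
    ++ cutsEmbedding k (cut ∘ (false ∷_)) (x ∘ (false ∷_)) u

hamming-cutsEmbedding : ∀ k (cut : Vec Bool k → Cut n) x u v →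
  hamming (cutsEmbedding k cut x u) (cutsEmbedding k cut x v) ≡ ∑ k (λ i → x i * separates (cut i) u v)
hamming-cutsEmbedding zero cut x u v = hamming-replicate (x []) _ _
hamming-cutsEmbedding (suc k) cut x u v =
  trans (hamming-++ (cutsEmbedding k _ _ u) (cutsEmbedding k _ _ v)
                    (cutsEmbedding k _ _ u) (cutsEmbedding k _ _ v))
        (cong₂ _+_ (hamming-cutsEmbedding k _ _ u v) (hamming-cutsEmbedding k _ _ u v))

module _ {n} (G : WeightedGraph n) where

  embeds⇒feasible : ∀ l {m} → Embeds G l m → ∃ λ x → Feasible (IsDist G) l x × ∑ n x ≡ m
  embeds⇒feasible l (f , emb) =
    multiplicity f ,
    (λ u v d isDist → subst (l * d ≤_) (hamming≡cutDist-multiplicity f u v) (emb u v d isDist)) ,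
    ∑-multiplicity f

  feasible⇒embeds : ∀ l x → Feasible (IsDist G) l x → Embeds G l (∑ n x)
  feasible⇒embeds l x feasible =
    cutsEmbedding n id x ,
    λ u v d isDist → subst (l * d ≤_) (sym (hamming-cutsEmbedding n id x u v)) (feasible u v d isDist)

  embeds-zero : Embeds G 0 0
  embeds-zero = (λ _ → []) , λ _ _ _ _ → z≤n

  embeds-++ : ∀ {a b m₁ m₂} → Embeds G a m₁ → Embeds G b m₂ → Embeds G (a + b) (m₁ + m₂)
  embeds-++ {a} {b} (f₁ , emb₁) (f₂ , emb₂) = (λ u → f₁ u ++ f₂ u) , λ u v d isDist →
    subst₂ _≤_ (sym (*-distribʳ-+ d a b)) (sym (hamming-++ (f₁ u) (f₁ v) (f₂ u) (f₂ v)))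
      (+-mono-≤ (emb₁ u v d isDist) (emb₂ u v d isDist))

  embeds-antitone : ∀ {l l′ m} → l′ ≤ l → Embeds G l m → Embeds G l′ m
  embeds-antitone l′≤l (f , emb) = f , λ u v d isDist → ≤-trans (*-monoˡ-≤ d l′≤l) (emb u v d isDist)

numberOfCuts : ℕ → ℕ
numberOfCuts n = ∑ n (λ _ → 1)

splitThreshold : ℕ → ℕ
splitThreshold n = (suc (numberOfCuts n) ^ n) ^ n

record Split (Δ : Demand n) (l : ℕ) (x : Weighting n) : Set where
  field
    a b        : ℕ
    x₁ x₂      : Weighting n
    a≥1        : 1 ≤ a
    b≥1        : 1 ≤ b
    a+b≡l      : a + b ≡ l
    ∑x₁+∑x₂≡∑x : ∑ n x₁ + ∑ n x₂ ≡ ∑ n x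
    feasible₁  : Feasible Δ a x₁
    feasible₂  : Feasible Δ b x₂

module Splitting {n} (Δ : Demand n) (l : ℕ) .{{_ : NonZero l}} (x : Weighting n)
                 (feasible : Feasible Δ l x) where

  q r : ℕ → Weighting n
  q k c = k * x c / l
  r k c = k * x c % l

  Q R : ℕ → Fin n → Fin n → ℕ
  Q k = cutDist (q k)
  R k = cutDist (r k)

  cutDist-scaled : ∀ k u v → k * cutDist x u v ≡ l * Q k u v + R k u v
  cutDist-scaled k u v = begin
    k * cutDist x u v                                  ≡⟨ ∑-distribˡ-* n k _ ⟨
    ∑ n (λ c → k * (x c * s c))                        ≡⟨ ∑-cong n per-cut ⟩
    ∑ n (λ c → l * (q k c * s c) + r k c * s c)        ≡⟨ ∑-distrib-+ n _ _ ⟩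
    ∑ n (λ c → l * (q k c * s c)) + R k u v            ≡⟨ cong (_+ R k u v) (∑-distribˡ-* n l _) ⟩
    l * Q k u v + R k u v                              ∎
    where
    open ≡-Reasoning
    s : Cut n → ℕ
    s c = separates c u v
    regroup : ∀ r q l s → (r + q * l) * s ≡ l * (q * s) + r * s
    regroup = solve-∀
    per-cut : ∀ c → k * (x c * s c) ≡ l * (q k c * s c) + r k c * s c
    per-cut c = begin
      k * (x c * s c)                   ≡⟨ *-assoc k (x c) (s c) ⟨
      k * x c * s c                     ≡⟨ cong (_* s c) (m≡m%n+[m/n]*n (k * x c) l) ⟩
      (r k c + q k c * l) * s c         ≡⟨ regroup (r k c) (q k c) l (s c) ⟩
      l * (q k c * s c) + r k c * s c   ∎

  R<[1+numberOfCuts]*l : ∀ k u v → R k u v < suc (numberOfCuts n) * l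
  R<[1+numberOfCuts]*l k u v = begin-strict
    R k u v
      ≤⟨ ∑-mono-≤ n (λ c → *-mono-≤ (<⇒≤ (m%n<n (k * x c) l)) (separates≤1 c u v)) ⟩
    ∑ n (λ _ → l * 1)          ≡⟨ ∑-distribˡ-* n l (λ _ → 1) ⟩
    l * numberOfCuts n         ≡⟨ *-comm l (numberOfCuts n) ⟩
    numberOfCuts n * l         <⟨ m<n+m (numberOfCuts n * l) (>-nonZero⁻¹ l) ⟩
    suc (numberOfCuts n) * l   ∎
    where open ≤-Reasoning

  profile : Fin l → Fin n → Fin n → Fin (suc (numberOfCuts n))
  profile i u v = fromℕ< (m<n*o⇒m/o<n (R<[1+numberOfCuts]*l (toℕ i) u v))

  profile-toℕ : ∀ i u v → toℕ (profile i u v) ≡ R (toℕ i) u v / l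
  profile-toℕ i u v = Fin.toℕ-fromℕ< _

  q-mono : ∀ {k k′} → k ≤ k′ → ∀ c → q k c ≤ q k′ c
  q-mono k≤k′ c = /-monoˡ-≤ l (*-monoˡ-≤ (x c) k≤k′)

  [k+l]*x≡k*x+x*l : ∀ k c → (k + l) * x c ≡ k * x c + x c * l
  [k+l]*x≡k*x+x*l k c = trans (*-distribʳ-+ (x c) k l) (cong (k * x c +_) (*-comm l (x c)))

  q-periodic : ∀ k c → q (k + l) c ≡ q k c + x c
  q-periodic k c = begin
    (k + l) * x c / l              ≡⟨ cong (_/ l) ([k+l]*x≡k*x+x*l k c) ⟩
    (k * x c + x c * l) / l        ≡⟨ +-distrib-/-∣ʳ (k * x c) (n∣m*n (x c)) ⟩
    k * x c / l + x c * l / l      ≡⟨ cong (q k c +_) (m*n/n≡m (x c) l) ⟩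
    q k c + x c                    ∎
    where open ≡-Reasoning

  R-periodic : ∀ k u v → R (k + l) u v ≡ R k u v
  R-periodic k u v = ∑-cong n λ c → cong (_* separates c u v) (begin
    (k + l) * x c % l              ≡⟨ cong (_% l) ([k+l]*x≡k*x+x*l k c) ⟩
    (k * x c + x c * l) % l        ≡⟨ [m+kn]%n≡m%n (k * x c) (x c) l ⟩
    r k c                          ∎)
    where open ≡-Reasoning

  piece : ℕ → ℕ → Weighting n
  piece k k′ c = q k′ c ∸ q k c

  -- Equal profiles put R k and R k′ within l of each other, so dividing
  -- k′ X − k X = (k′ − k) X ≥ l (k′ − k) d by l leaves Q k′ − Q k ≥ (k′ − k) d.
  piece-feasible : ∀ {k k′} → k ≤ k′ → (∀ u v → R k u v / l ≡ R k′ u v / l) →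
    Feasible Δ (k′ ∸ k) (piece k k′)
  piece-feasible {k} {k′} k≤k′ sameProfile u v d demand = begin
    a * d                       ≤⟨ m+n≤o⇒m≤o∸n (a * d) gap ⟩
    Q k′ u v ∸ Q k u v          ≡⟨ cutDist-∸ (q k′) (q k) (q-mono k≤k′) u v ⟨
    cutDist (piece k k′) u v    ∎
    where
    open ≤-Reasoning
    a X : ℕ
    a = k′ ∸ k
    X = cutDist x u v
    scaled : l * Q k′ u v + R k′ u v ≡ a * X + (l * Q k u v + R k u v)
    scaled = begin-equality
      l * Q k′ u v + R k′ u v          ≡⟨ cutDist-scaled k′ u v ⟨
      k′ * X                           ≡⟨ cong (_* X) (m∸n+n≡m k≤k′) ⟨
      (a + k) * X                      ≡⟨ *-distribʳ-+ X a k ⟩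
      a * X + k * X                    ≡⟨ cong (a * X +_) (cutDist-scaled k u v) ⟩
      a * X + (l * Q k u v + R k u v)  ∎
    l*[a*d]≤a*X : l * (a * d) ≤ a * X
    l*[a*d]≤a*X = begin
      l * (a * d)   ≡⟨ x*[y*z]≡y*[x*z] l a d ⟩
      a * (l * d)   ≤⟨ *-monoʳ-≤ a (feasible u v d demand) ⟩
      a * X         ∎
      where x*[y*z]≡y*[x*z] : ∀ x y z → x * (y * z) ≡ y * (x * z)
            x*[y*z]≡y*[x*z] = solve-∀
    gap : a * d + Q k u v ≤ Q k′ u v
    gap = quotient-gap l scaled (m/o≡n/o⇒n<m+o _ _ l (sameProfile u v)) l*[a*d]≤a*X

  split : splitThreshold n < l → Split Δ l x
  split threshold<l with pigeonhole-matrix threshold<l profile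
  ... | i , j , i<j , sameProfile = record
    { a          = k′ ∸ k
    ; b          = (k + l) ∸ k′
    ; x₁         = piece k k′
    ; x₂         = piece k′ (k + l)
    ; a≥1        = m<n⇒0<n∸m i<j
    ; b≥1        = m<n⇒0<n∸m k′<k+l
    ; a+b≡l      = trans ([n∸m]+[o∸n]≡o∸m k≤k′ k′≤k+l) (m+n∸m≡n k l)
    ; ∑x₁+∑x₂≡∑x = trans (sym (∑-distrib-+ n _ _)) (∑-cong n pieces-sum)
    ; feasible₁  = piece-feasible k≤k′ sameR
    ; feasible₂  = piece-feasible k′≤k+l λ u v →
                     trans (sym (sameR u v)) (cong (_/ l) (sym (R-periodic k u v)))
    }
    where
    k k′ : ℕ
    k = toℕ i
    k′ = toℕ j
    k≤k′ : k ≤ k′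
    k≤k′ = <⇒≤ i<j
    k′<k+l : k′ < k + l
    k′<k+l = ≤-trans (Fin.toℕ<n j) (m≤n+m l k)
    k′≤k+l : k′ ≤ k + l
    k′≤k+l = <⇒≤ k′<k+l
    sameR : ∀ u v → R k u v / l ≡ R k′ u v / l
    sameR u v = trans (sym (profile-toℕ i u v)) (trans (cong toℕ (sameProfile u v)) (profile-toℕ j u v))
    pieces-sum : ∀ c → piece k k′ c + piece k′ (k + l) c ≡ x c
    pieces-sum c = begin-equality
      piece k k′ c + piece k′ (k + l) c   ≡⟨ [n∸m]+[o∸n]≡o∸m (q-mono k≤k′ c) (q-mono k′≤k+l c) ⟩
      q (k + l) c ∸ q k c                 ≡⟨ cong (_∸ q k c) (q-periodic k c) ⟩
      q k c + x c ∸ q k c                 ≡⟨ m+n∸m≡n (q k c) (x c) ⟩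
      x c                                 ∎
      where open ≤-Reasoning

cross-≤-trans : ∀ {a₁ b₁ a₂ b₂ a₃ b₃} .{{_ : NonZero b₂}} →
  a₁ * b₂ ≤ a₂ * b₁ → a₂ * b₃ ≤ a₃ * b₂ → a₁ * b₃ ≤ a₃ * b₁
cross-≤-trans {a₁} {b₁} {a₂} {b₂} {a₃} {b₃} le₁₂ le₂₃ = *-cancelʳ-≤ (a₁ * b₃) (a₃ * b₁) b₂ (begin
  a₁ * b₃ * b₂   ≡⟨ swap a₁ b₃ b₂ ⟩
  a₁ * b₂ * b₃   ≤⟨ *-monoˡ-≤ b₃ le₁₂ ⟩
  a₂ * b₁ * b₃   ≡⟨ swap a₂ b₁ b₃ ⟩
  a₂ * b₃ * b₁   ≤⟨ *-monoˡ-≤ b₁ le₂₃ ⟩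
  a₃ * b₂ * b₁   ≡⟨ swap a₃ b₂ b₁ ⟩
  a₃ * b₁ * b₂   ∎)
  where
  open ≤-Reasoning
  swap : ∀ x y z → x * y * z ≡ x * z * y
  swap = solve-∀

module _ (f : ℕ → ℕ) where

  SplitsBeyond : ℕ → Set
  SplitsBeyond B = ∀ l → B < l → ∃₂ λ a b → 1 ≤ a × 1 ≤ b × a + b ≡ l × f a + f b ≤ f l

  MinimalRatioUpTo : ℕ → ℕ → Set
  MinimalRatioUpTo N μ = ∀ l → 1 ≤ l → l ≤ N → f μ * l ≤ f l * μ

  MinimalRatio : ℕ → Set
  MinimalRatio μ = ∀ l → 1 ≤ l → f μ * l ≤ f l * μ

  MinimalRatioUpTo-suc : ∀ {N μ} → MinimalRatioUpTo N μ → f μ * suc N ≤ f (suc N) * μ →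
    MinimalRatioUpTo (suc N) μ
  MinimalRatioUpTo-suc minimal le l 1≤l l≤1+N with m≤n⇒m<n∨m≡n l≤1+N
  ... | inj₁ l<1+N = minimal l 1≤l (s≤s⁻¹ l<1+N)
  ... | inj₂ refl = le

  argmin-ratio : ∀ N → ∃ λ j → MinimalRatioUpTo (suc N) (suc j)
  argmin-ratio zero = 0 , λ { (suc zero) _ _ → ≤-refl ; (suc (suc _)) _ (s≤s ()) }
  argmin-ratio (suc N) with argmin-ratio N
  ... | j , minimal with f (suc j) * suc (suc N) ≤? f (suc (suc N)) * suc j
  ...   | yes le = j , MinimalRatioUpTo-suc minimal le
  ...   | no ≰ = suc N , MinimalRatioUpTo-suc
            (λ l 1≤l l≤1+N → cross-≤-trans {a₁ = f (suc (suc N))} {a₂ = f (suc j)} {a₃ = f l}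
                                (<⇒≤ (≰⇒> ≰)) (minimal l 1≤l l≤1+N)) ≤-refl

  -- Strong induction: if l = a + b with f a + f b ≤ f l, the bound for l follows from a and b.
  MinimalRatioUpTo⇒MinimalRatio : ∀ {B μ} → SplitsBeyond B → MinimalRatioUpTo (suc B) μ →
    MinimalRatio μ
  MinimalRatioUpTo⇒MinimalRatio {B} {μ} splits minimalUpTo = <-rec _ go
    where
    go : ∀ l → (∀ {l′} → l′ < l → 1 ≤ l′ → f μ * l′ ≤ f l′ * μ) → 1 ≤ l → f μ * l ≤ f l * μ
    go l rec 1≤l with l ≤? suc B
    ... | yes l≤1+B = minimalUpTo l 1≤l l≤1+B
    ... | no l≰1+B with splits l (<-trans (n<1+n B) (≰⇒> l≰1+B))
    ... | a , b , 1≤a , 1≤b , refl , fa+fb≤f[a+b] = begin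
      f μ * (a + b)       ≡⟨ *-distribˡ-+ (f μ) a b ⟩
      f μ * a + f μ * b   ≤⟨ +-mono-≤ (rec (m<m+n a 1≤b) 1≤a) (rec (m<n+m b 1≤a) 1≤b) ⟩
      f a * μ + f b * μ   ≡⟨ *-distribʳ-+ μ (f a) (f b) ⟨
      (f a + f b) * μ     ≤⟨ *-monoˡ-≤ μ fa+fb≤f[a+b] ⟩
      f (a + b) * μ       ∎
      where open ≤-Reasoning

  module _ (subadditive : ∀ a b → f (a + b) ≤ f a + f b) (f0≡0 : f 0 ≡ 0) where

    f[q*m]≤q*f[m] : ∀ q m → f (q * m) ≤ q * f m
    f[q*m]≤q*f[m] zero m = ≤-reflexive f0≡0
    f[q*m]≤q*f[m] (suc q) m = ≤-trans (subadditive m (q * m)) (+-monoʳ-≤ (f m) (f[q*m]≤q*f[m] q m))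

    ratio-upper : f Preserves _≤_ ⟶ _≤_ → ∀ m .{{_ : NonZero m}} l → f l * m ≤ f m * l + f m * m
    ratio-upper mono m l = begin
      f l * m                 ≤⟨ *-monoˡ-≤ m (≤-trans (mono l≤[1+q]*m) (f[q*m]≤q*f[m] (suc q) m)) ⟩
      suc q * f m * m         ≡⟨ regroup q (f m) m ⟩
      f m * (q * m + m)       ≤⟨ *-monoʳ-≤ (f m) (+-monoˡ-≤ m (m/n*n≤m l m)) ⟩
      f m * (l + m)           ≡⟨ *-distribˡ-+ (f m) l m ⟩
      f m * l + f m * m       ∎
      where
      open ≤-Reasoning
      q : ℕ
      q = l / m
      regroup : ∀ q c m → suc q * c * m ≡ c * (q * m + m)
      regroup = solve-∀
      l≤[1+q]*m : l ≤ suc q * m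
      l≤[1+q]*m = <⇒≤ (begin-strict
        l              ≡⟨ m≡m%n+[m/n]*n l m ⟩
        l % m + q * m  <⟨ +-monoˡ-< (q * m) (m%n<n l m) ⟩
        m + q * m      ∎)

+m*+n-+o*+p≡+[m*n∸o*p] : ∀ m n o p → o * p ≤ m * n →
  ℤ.+ m ℤ.* ℤ.+ n ℤ.+ (ℤ.- (ℤ.+ o)) ℤ.* ℤ.+ p ≡ ℤ.+ (m * n ∸ o * p)
+m*+n-+o*+p≡+[m*n∸o*p] m n o p o*p≤m*n = begin
  ℤ.+ m ℤ.* ℤ.+ n ℤ.+ (ℤ.- (ℤ.+ o)) ℤ.* ℤ.+ p
    ≡⟨ cong₂ ℤ._+_ (ℤ.pos-* m n) (ℤ.neg-distribˡ-* (ℤ.+ o) (ℤ.+ p)) ⟨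
  ℤ.+ (m * n) ℤ.+ ℤ.- (ℤ.+ o ℤ.* ℤ.+ p)
    ≡⟨ cong (λ t → ℤ.+ (m * n) ℤ.+ ℤ.- t) (ℤ.pos-* o p) ⟨
  ℤ.+ (m * n) ℤ.+ ℤ.- ℤ.+ (o * p)      ≡⟨ ℤ.m-n≡m⊖n (m * n) (o * p) ⟩
  (m * n) ℤ.⊖ (o * p)                  ≡⟨ ℤ.⊖-≥ o*p≤m*n ⟩
  ℤ.+ (m * n ∸ o * p)                  ∎
  where open ≡-Reasoning

-- Computed in ℚᵘ, the difference is (a(j+1) − b(k+1)) / ((k+1)(j+1)), whose numerator is
-- at most b(j+1).
∣a÷[1+k]-b÷[1+j]∣<ε : ∀ a b k j (ε : ℚ) → ℚ.0ℚ ℚ.< ε →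
  b * suc k ≤ a * suc j → a * suc j ≤ b * suc k + b * suc j → b * ℚ.↧ₙ ε < suc k →
  ℚ.∣ a ÷ suc k ℚ.- b ÷ suc j ∣ ℚ.< ε
∣a÷[1+k]-b÷[1+j]∣<ε a b k j (mkℚ (ℤ.+ zero) _ _) (ℚ.*<* (ℤ.+<+ ())) _ _ _
∣a÷[1+k]-b÷[1+j]∣<ε a b k j (mkℚ ℤ.-[1+ _ ] _ _) (ℚ.*<* ()) _ _ _
∣a÷[1+k]-b÷[1+j]∣<ε a b k j (mkℚ ℤ.+[1+ p ] e _) _ lower upper b*e<l =
  ℚ.toℚᵘ-cancel-< (ℚᵘ.<-respˡ-≃ (ℚᵘ.≃-sym toℚᵘ-difference) difference<ε)
  where
  x y : ℚ
  x = a ÷ suc k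
  y = b ÷ suc j
  xᵘ yᵘ : ℚᵘ.ℚᵘ
  xᵘ = ℚᵘ.mkℚᵘ (ℤ.+ a) k
  yᵘ = ℚᵘ.mkℚᵘ (ℤ.+ b) j
  toℚᵘ-difference : ℚ.toℚᵘ ℚ.∣ x ℚ.- y ∣ ℚᵘ.≃ ℚᵘ.∣ xᵘ ℚᵘ.- yᵘ ∣
  toℚᵘ-difference = ℚᵘ.≃-trans (ℚ.toℚᵘ-homo-∣-∣ (x ℚ.- y)) (ℚᵘ.∣-∣-cong
    (ℚᵘ.≃-trans (ℚ.toℚᵘ-homo-+ x (ℚ.- y))
      (ℚᵘ.+-cong (ℚ.toℚᵘ-fromℚᵘ xᵘ) (ℚᵘ.≃-trans (ℚ.toℚᵘ-homo‿- y) (ℚᵘ.-‿cong (ℚ.toℚᵘ-fromℚᵘ yᵘ))))))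
  numerator-bound : (a * suc j ∸ b * suc k) * suc e < suc p * (suc k * suc j)
  numerator-bound = begin-strict
    (a * suc j ∸ b * suc k) * suc e   ≤⟨ *-monoˡ-≤ (suc e) (m≤n+o⇒m∸n≤o (a * suc j) (b * suc k) upper) ⟩
    b * suc j * suc e                 ≡⟨ regroup b (suc j) (suc e) ⟩
    suc j * (b * suc e)               <⟨ *-monoʳ-< (suc j) b*e<l ⟩
    suc j * suc k                     ≡⟨ *-comm (suc j) (suc k) ⟩
    suc k * suc j                     ≤⟨ m≤n*m (suc k * suc j) (suc p) ⟩
    suc p * (suc k * suc j)           ∎
    where
    open ≤-Reasoning
    regroup : ∀ b j e → b * j * e ≡ j * (b * e)
    regroup = solve-∀
  difference<ε : ℚᵘ.∣ xᵘ ℚᵘ.- yᵘ ∣ ℚᵘ.< ℚᵘ.mkℚᵘ ℤ.+[1+ p ] e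
  difference<ε = ℚᵘ.*<* (subst₂ ℤ._<_
    (sym (trans (cong (λ t → ℤ.+ ℤ.∣ t ∣ ℤ.* ℤ.+ suc e) (+m*+n-+o*+p≡+[m*n∸o*p] a (suc j) b (suc k) lower))
                (sym (ℤ.pos-* (a * suc j ∸ b * suc k) (suc e)))))
    (ℤ.pos-* (suc p) (suc k * suc j))
    (ℤ.+<+ numerator-bound))

ratio-converges : ∀ {f : ℕ → ℕ} {j} → MinimalRatio f (suc j) →
  (∀ l → f l * suc j ≤ f (suc j) * l + f (suc j) * suc j) →
  ∀ ε → ℚ.0ℚ ℚ.< ε → ∃ λ N → ∀ k → N ≤ suc k → ℚ.∣ f (suc k) ÷ suc k ℚ.- f (suc j) ÷ suc j ∣ ℚ.< ε
ratio-converges {f} {j} minimal upper ε ε>0 =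
  suc (f (suc j) * ℚ.↧ₙ ε) , λ k N≤1+k →
    ∣a÷[1+k]-b÷[1+j]∣<ε (f (suc k)) (f (suc j)) k j ε ε>0 (minimal (suc k) (s≤s z≤n)) (upper (suc k)) N≤1+k

module Distances {n} (G : WeightedGraph n) where

  open DecMembership (Fin._≟_ {n}) using (_∈?_)

  IsDist-unique : ∀ {u v d d′} → IsDist G u v d → IsDist G u v d′ → d ≡ d′
  IsDist-unique ((p , p≡d) , d-minimal) ((p′ , p′≡d′) , d′-minimal) =
    ≤-antisym (subst (_ ≤_) p′≡d′ (d-minimal p′)) (subst (_ ≤_) p≡d (d′-minimal p))

  IsDist-self : ∀ {u d} → IsDist G u u d → d ≡ 0
  IsDist-self {u} (_ , minimal) = n≤0⇒n≡0 (minimal (stop u , [] ∷ []))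

  steps : ∀ {u v} → Walk (adj G) u v → ℕ
  steps (stop _) = 0
  steps (step _ _ p) = suc (steps p)

  steps≤walkWeight : ∀ {u v} (p : Walk (adj G) u v) → steps p ≤ walkWeight (w G) p
  steps≤walkWeight (stop _) = z≤n
  steps≤walkWeight (step u {x} e p) = +-mono-≤ (w-pos G u x e) (steps≤walkWeight p)

  WalkWithin : ℕ → ℕ → Fin n → Fin n → Set
  WalkWithin s k u v = ∃ λ (p : Walk (adj G) u v) → steps p ≤ s × walkWeight (w G) p ≤ k

  walkWithin? : ∀ s k u v → Dec (WalkWithin s k u v)
  walkWithin? s k u v with u Fin.≟ v
  walkWithin? s k u v | yes refl = yes (stop u , z≤n , z≤n)
  walkWithin? zero k u v | no u≢v = no λ { (stop _ , _) → u≢v refl ; (step _ _ _ , () , _) }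
  walkWithin? (suc s) k u v | no u≢v = Dec.map′ extend shorten (Fin.any? firstStep?)
    where
    FirstStep : Fin n → Set
    FirstStep x = adj G u x ≡ true × w G u x ≤ k × WalkWithin s (k ∸ w G u x) x v
    firstStep? : ∀ x → Dec (FirstStep x)
    firstStep? x = (adj G u x Bool.≟ true) ×-dec (w G u x ≤? k) ×-dec walkWithin? s (k ∸ w G u x) x v
    extend : ∃ FirstStep → WalkWithin (suc s) k u v
    extend (x , e , w≤k , p , p-steps , p-weight) =
      step u e p , s≤s p-steps , ≤-trans (+-monoʳ-≤ (w G u x) p-weight) (≤-reflexive (m+[n∸m]≡n w≤k))
    shorten : WalkWithin (suc s) k u v → ∃ FirstStep
    shorten (stop _ , _) = contradiction refl u≢v
    shorten (step _ {x} e p , s≤s p-steps , weight) =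
      x , e , m+n≤o⇒m≤o (w G u x) weight , p , p-steps ,
      m+n≤o⇒m≤o∸n (walkWeight (w G) p) (subst (_≤ k) (+-comm (w G u x) _) weight)

  pathWithin : ∀ {u v} (q : Path (adj G) u v) →
    WalkWithin (pathWeight (w G) q) (pathWeight (w G) q) u v
  pathWithin (p , _) = p , steps≤walkWeight p , ≤-refl

  suffix : ∀ {u y v} (p : Walk (adj G) y v) → u ∈ vertices p →
    ∃ λ (s : Walk (adj G) u v) →
      walkWeight (w G) s ≤ walkWeight (w G) p × (Unique (vertices p) → Unique (vertices s))
  suffix (stop y) (here refl) = stop y , ≤-refl , id
  suffix (step y e p) (here refl) = step y e p , ≤-refl , id
  suffix (step y {x} e p) (there u∈p) with suffix p u∈p
  ... | s , s≤p , unique = s , ≤-trans s≤p (m≤n+m _ (w G y x)) , λ { (_ ∷ uniq) → unique uniq }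

  shortcut : ∀ {u v} (p : Walk (adj G) u v) →
    ∃ λ (q : Path (adj G) u v) → pathWeight (w G) q ≤ walkWeight (w G) p
  shortcut (stop u) = (stop u , [] ∷ []) , ≤-refl
  shortcut (step u {x} e p) with shortcut p
  ... | (q , uniq) , q≤p with u ∈? vertices q
  ...   | no u∉q = (step u e q , ¬Any⇒All¬ _ u∉q ∷ uniq) , +-monoʳ-≤ (w G u x) q≤p
  ...   | yes u∈q with suffix q u∈q
  ...     | s , s≤q , unique = (s , unique uniq) , ≤-trans s≤q (≤-trans q≤p (m≤n+m _ (w G u x)))

  distance : Connected G → ∀ u v → ∃ (IsDist G u v)
  distance connected u v with least (λ k → walkWithin? k k u v) (pathWithin (connected u v))
  ... | d , (p , _ , p≤d) , below with shortcut p
  ...   | q , q≤p = d , (q , ≤-antisym (≤-trans q≤p p≤d) (minimal q)) , minimal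
    where
    minimal : (q : Path (adj G) u v) → d ≤ pathWeight (w G) q
    minimal q = ≮⇒≥ λ lt → below _ lt (pathWithin q)

module MinimalEmbeddings {n} (G : WeightedGraph n) (connected : Connected G) where

  open Distances G

  D : Fin n → Fin n → ℕ
  D u v = proj₁ (distance connected u v)

  D-IsDist : ∀ u v → IsDist G u v (D u v)
  D-IsDist u v = proj₂ (distance connected u v)

  embeds? : ∀ l m → Dec (Embeds G l m)
  embeds? l m =
    Dec.map′ fromTable toTable (searchable-Vec (searchable-Vec searchable-Bool m) n table?)
    where
    Table : Vec (Vec Bool m) n → Set
    Table V = ∀ u v → l * D u v ≤ hamming (lookup V u) (lookup V v)
    table? : Decidable Table
    table? V = Fin.all? λ u → Fin.all? λ v → l * D u v ≤? hamming (lookup V u) (lookup V v)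
    fromTable : ∃ Table → Embeds G l m
    fromTable (V , ok) = lookup V , λ u v d isDist →
      subst (λ t → l * t ≤ _) (IsDist-unique (D-IsDist u v) isDist) (ok u v)
    toTable : Embeds G l m → ∃ Table
    toTable (f , emb) = tabulate f , λ u v →
      subst₂ (λ a b → l * D u v ≤ hamming a b) (sym (lookup∘tabulate f u)) (sym (lookup∘tabulate f v))
        (emb u v (D u v) (D-IsDist u v))

  diameter : ℕ
  diameter = maxOver (λ u → maxOver (D u))

  D≤diameter : ∀ u v → D u v ≤ diameter
  D≤diameter u v = ≤-trans (≤-maxOver (D u) v) (≤-maxOver (λ u → maxOver (D u)) u)

  uniform-feasible : ∀ l → Feasible (IsDist G) l (λ _ → l * diameter)
  uniform-feasible l u v d isDist with u Fin.≟ v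
  ... | yes refl = ≤-trans (≤-reflexive (trans (cong (l *_) (IsDist-self isDist)) (*-zeroʳ l))) z≤n
  ... | no u≢v = begin
    l * d                                ≡⟨ cong (l *_) (IsDist-unique isDist (D-IsDist u v)) ⟩
    l * D u v                            ≤⟨ *-monoʳ-≤ l (D≤diameter u v) ⟩
    l * diameter                         ≡⟨ *-identityʳ (l * diameter) ⟨
    l * diameter * 1                     ≡⟨ cong (l * diameter *_) (separates-singleton u≢v) ⟨
    l * diameter * separates (singleton u) u v   ≤⟨ ≤-∑ n _ (singleton u) ⟩
    cutDist (λ _ → l * diameter) u v     ∎
    where open ≤-Reasoning

  -- Opaque because c is an exhaustive search that type checking must never unfold.
  opaque
    c-exists : ∀ l → ∃ (IsC G l)
    c-exists l = least (embeds? l) (feasible⇒embeds G l (λ _ → l * diameter) (uniform-feasible l))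

  c : ℕ → ℕ
  c l = proj₁ (c-exists l)

  c-IsC : ∀ l → IsC G l (c l)
  c-IsC l = proj₂ (c-exists l)

  c-embeds : ∀ l → Embeds G l (c l)
  c-embeds l = proj₁ (c-IsC l)

  c-minimal : ∀ l {m} → Embeds G l m → c l ≤ m
  c-minimal l = IsLeast⇒≤ (c-IsC l)

  c-subadditive : ∀ a b → c (a + b) ≤ c a + c b
  c-subadditive a b = c-minimal (a + b) (embeds-++ G {a} {b} (c-embeds a) (c-embeds b))

  c-monotone : c Preserves _≤_ ⟶ _≤_
  c-monotone {l′} {l} l′≤l = c-minimal l′ (embeds-antitone G {l} {l′} l′≤l (c-embeds l))

  c-zero : c 0 ≡ 0
  c-zero = n≤0⇒n≡0 (c-minimal 0 (embeds-zero G))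

  c-splits : SplitsBeyond c (splitThreshold n)
  c-splits l@(suc _) threshold<l with embeds⇒feasible G l (c-embeds l)
  ... | x , feasible , ∑x≡cl = a , b , a≥1 , b≥1 , a+b≡l , (begin
    c a + c b          ≤⟨ +-mono-≤ (c-minimal a (feasible⇒embeds G a x₁ feasible₁))
                                   (c-minimal b (feasible⇒embeds G b x₂ feasible₂)) ⟩
    ∑ n x₁ + ∑ n x₂    ≡⟨ ∑x₁+∑x₂≡∑x ⟩
    ∑ n x              ≡⟨ ∑x≡cl ⟩
    c l                ∎)
    where
    open Split (Splitting.split (IsDist G) l x feasible threshold<l)
    open ≤-Reasoning

  c-converges⇒BetaIs : ∀ {q} →
    (∀ ε → ℚ.0ℚ ℚ.< ε → ∃ λ N → ∀ k → N ≤ suc k → ℚ.∣ c (suc k) ÷ suc k ℚ.- q ∣ ℚ.< ε) →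
    BetaIs G q
  c-converges⇒BetaIs {q} converges ε ε>0 with converges ε ε>0
  ... | N , close = N , λ k N≤1+k c′ isC →
    subst (λ t → ℚ.∣ t ÷ suc k ℚ.- q ∣ ℚ.< ε) (IsLeast-unique (c-IsC (suc k)) isC) (close k N≤1+k)

corollary8 : ∀ (n : ℕ) (G : WeightedGraph n) → Connected G →
    -- c_λ(G,w) is well defined for every positive integer λ
    (∀ k → Σ ℕ (λ c → IsC G (suc k) c)) ×
    -- there is a positive integer μ = suc j with β(G,w) = c_μ(G,w)/μ
    Σ ℕ (λ j → Σ ℕ (λ c → IsC G (suc j) c × BetaIs G (c ÷ suc j)))
corollary8 n G connected = (λ k → c-exists (suc k)) , j , c (suc j) , c-IsC (suc j) , β
  where
  open MinimalEmbeddings G connected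
  j : ℕ
  j = proj₁ (argmin-ratio c (splitThreshold n))
  minimal : MinimalRatio c (suc j)
  minimal = MinimalRatioUpTo⇒MinimalRatio c c-splits (proj₂ (argmin-ratio c (splitThreshold n)))
  β : BetaIs G (c (suc j) ÷ suc j)
  β = c-converges⇒BetaIs
        (ratio-converges {f = c} minimal (ratio-upper c c-subadditive c-zero c-monotone (suc j)))
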